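{- Let $n\ge 1$ and $h\ge 0$ be integers and let $L=\{0,1,\dots,n-1\}$. Define forests (sets of labeled rooted trees, up to label-preserving isomorphism of rooted trees) recursively by $G_0=\{\mathrm{root}\}$ and, for $i\ge 1$, $$G_i=\{\mathrm{root},\ \mathcal{R}(T_0,G_{i-1})\}\wedge\{\mathrm{root},\ \mathcal{R}(T_1,G_{i-1})\}\wedge\cdots\wedge\{\mathrm{root},\ \mathcal{R}(T_{n-1},G_{i-1})\}.$$ Then the forest $G_h$ contains every rooted tree of height at most $h$ whose vertices carry a valid label assignment with labels from $L$.
   Context: A rooted tree is a tree with a distinguished vertex, the root. The height of a rooted tree is the maximum distance (number of edges) from the root to a vertex. A label assignment on a rooted tree is valid if the root is unlabeled (denoted $r$), every non-root vertex receives a label, and no two sibling vertices (children of the same parent) receive the same label. Trees are considered up to isomorphism of rooted trees preserving labels (children are unordered). $\mathrm{root}$ denotes the tree consisting of the root vertex alone. $T_k$ denotes the tree consisting of the root and a single child labeled $k$. Grafting of trees: $T_\alpha\wedge T_\beta$ is the rooted tree obtained by identifying the roots of $T_\alpha$ and $T_\beta$ (so the children subtrees of the new root are those of $T_\alpha$ together with those of $T_\beta$); $\mathrm{root}$ is the identity for grafting. Grafting of forests: for forests $\mathcal{F},\mathcal{G}$, $\mathcal{F}\wedge\mathcal{G}=\{T\wedge T' : T\in\mathcal{F},\,T'\in\mathcal{G}\}$. Raising: for a tree $T_\alpha$ and forest $\mathcal{F}$, $\mathcal{R}(T_\alpha,\mathcal{F})$ is the forest obtained by replacing each tree $T\in\mathcal{F}$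 with the tree obtained from $T_\alpha$ by attaching a copy of $T$ at every leaf of $T_\alpha$ (identifying the root of the copy of $T$ with that leaf); by convention $\mathcal{R}(T_\alpha,\mathrm{root})=T_\alpha$. In the recursion, $\{\mathrm{root},\mathcal{R}(T_k,G_{i-1})\}$ denotes the forest consisting of $\mathrm{root}$ together with all trees of $\mathcal{R}(T_k,G_{i-1})$. -}

module Defs where

open import Data.Nat using (ℕ; zero; suc; _⊔_)
open import Data.Fin using (Fin)
open import Data.Product using (_×_; _,_; proj₁; proj₂)
open import Data.List using (List; []; _∷_; _++_; map; concatMap; foldr; allFin; [_])
open import Data.List.Relation.Unary.All using (All)
open import Data.List.Relation.Unary.Unique.Propositional using (Unique)
open import Data.List.Relation.Binary.Pointwise using (Pointwise)
open import Data.List.Relation.Binary.Permutation.Propositional using (_↭_)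
open import Relation.Binary.PropositionalEquality using (_≡_)

-- Rooted trees whose non-root vertices carry labels from L = Fin n.
-- A node is given by the (unordered, hence listed in arbitrary order) list of its
-- children, each child being a label together with the subtree hanging from it.
-- The root itself carries no label.
data Tree (n : ℕ) : Set where
  node : List (Fin n × Tree n) → Tree n

module _ {n : ℕ} where

  root : Tree n
  root = node []

  T : Fin n → Tree n
  T k = node ((k , root) ∷ [])

  mutual
    height : Tree n → ℕ
    height (node cs) = heights cs

    heights : List (Fin n × Tree n) → ℕ
    heights [] = zero
    heights ((_ , t) ∷ cs) = suc (height t) ⊔ heights cs

  data Valid : Tree n → Set where
    valid : ∀ {cs} → Unique (map proj₁ cs) → All (λ c → Valid (proj₂ c)) cs →
            Valid (node cs)

  data _≅_ : Tree n → Tree n → Set where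
    iso : ∀ {cs es ds} → cs ↭ es →
          Pointwise (λ c d → proj₁ c ≡ proj₁ d × proj₂ c ≅ proj₂ d) es ds →
          node cs ≅ node ds

  _∧_ : Tree n → Tree n → Tree n
  node cs ∧ node ds = node (cs ++ ds)

  Forest : Set
  Forest = List (Tree n)

  _∧F_ : Forest → Forest → Forest
  F ∧F G = concatMap (λ t → map (t ∧_) G) F

  mutual
    attach : Tree n → Tree n → Tree n
    attach (node []) s = s
    attach (node (c ∷ cs)) s = node (attachCs (c ∷ cs) s)

    attachCs : List (Fin n × Tree n) → Tree n → List (Fin n × Tree n)
    attachCs [] s = []
    attachCs ((l , t) ∷ cs) s = (l , attach t s) ∷ attachCs cs s

  raise : Tree n → Forest → Forest
  raise tα F = map (attach tα) F

G : (n : ℕ) → ℕ → Forest {n}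
G n zero = [ root ]
G n (suc i) = foldr (λ k acc → (root ∷ raise (T k) (G n i)) ∧F acc) [ root ] (allFin n)

module Submission where

-- Write Layer F ks for the forest  {root, R(T_k,F)} ∧ … (k ∈ ks) ∧ {root}, so that
-- G (h+1) = Layer (G h) L.  A tree of Layer F ks is obtained by choosing, for each
-- label k ∈ ks, either nothing or a single child labelled k carrying a tree of F.
--
-- The heart of the proof is  layer-complete : a root whose children have pairwise
-- distinct labels drawn from ks, each child subtree being isomorphic to some tree of
-- F, is isomorphic to a tree of Layer F ks.  It is proved by induction on ks: for the
-- first label k, either no child carries k (skip k), or the child carrying k can be
-- moved to the front of the child list (a permutation, hence an isomorphism) and
-- matched with the R(T_k,F)-factor.
--
-- The theorem then follows by induction on h: children of a tree of height ≤ h+1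
-- have height ≤ h, so their subtrees are covered by G h, and Layer applies with
-- ks = L.

open import Defs
open import Data.Nat using (ℕ; zero; suc; _≤_; _<_)
open import Data.Nat.Properties using (m⊔n≤o⇒m≤o; m⊔n≤o⇒n≤o; ≤-pred)
open import Data.Fin using (Fin; _≟_)
open import Data.Product using (∃; ∃₂; _×_; _,_; proj₁; proj₂)
open import Data.Sum using (_⊎_; inj₁; inj₂)
open import Data.List using (List; []; _∷_; [_]; foldr; allFin)
open import Data.List.Membership.Propositional using (_∈_)
open import Data.List.Membership.Propositional.Properties using (∈-map⁺; ∈-concat⁺′; ∈-allFin)
open import Data.List.Relation.Unary.Any using (here; there)
open import Data.List.Relation.Unary.All as All using (All; []; _∷_)
open import Data.List.Relation.Unary.AllPairs using (AllPairs; []; _∷_)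
import Data.List.Relation.Unary.AllPairs.Properties as AllPairs
open import Data.List.Relation.Binary.Pointwise using ([]; _∷_)
open import Data.List.Relation.Binary.Permutation.Propositional using (_↭_; refl; prep; swap; trans; ↭⇒↭ₛ)
open import Data.List.Relation.Binary.Permutation.Propositional.Properties using (All-resp-↭)
import Data.List.Relation.Binary.Permutation.Setoid.Properties as SetoidPermutation
open import Function using (_∘_)
open import Relation.Binary.Definitions using (DecidableEquality)
open import Relation.Binary.PropositionalEquality using (_≢_; sym; resp₂; setoid)
  renaming (refl to ≡-refl)
open import Relation.Nullary using (yes; no; contradiction)

module _ {A B : Set} (_≟A_ : DecidableEquality A) where

  extract : (k : A) (xs : List (A × B)) →
            All (λ x → k ≢ proj₁ x) xs ⊎ ∃₂ λ b ys → xs ↭ (k , b) ∷ ys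
  extract k [] = inj₁ []
  extract k ((a , b) ∷ xs) with k ≟A a
  ... | yes ≡-refl = inj₂ (b , xs , refl)
  ... | no k≢a with extract k xs
  ...   | inj₁ absent             = inj₁ (k≢a ∷ absent)
  ...   | inj₂ (b′ , ys , xs↭k∷ys) =
          inj₂ (b′ , (a , b) ∷ ys , trans (prep _ xs↭k∷ys) (swap _ _ refl))

DistinctKeys : {A B : Set} → A × B → A × B → Set
DistinctKeys x y = proj₁ x ≢ proj₁ y

distinct-resp-↭ : {A B : Set} {xs ys : List (A × B)} →
                  xs ↭ ys → AllPairs DistinctKeys xs → AllPairs DistinctKeys ys
distinct-resp-↭ {A} {B} p =
  SetoidPermutation.AllPairs-resp-↭ (setoid (A × B)) (λ x≢y → x≢y ∘ sym) (resp₂ DistinctKeys) (↭⇒↭ₛ p)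

drop-key : {A B : Set} {k : A} {ks : List A} {xs : List (A × B)} →
           All (λ x → proj₁ x ∈ k ∷ ks) xs → All (λ x → k ≢ proj₁ x) xs →
           All (λ x → proj₁ x ∈ ks) xs
drop-key [] [] = []
drop-key (here a≡k ∷ _) (k≢a ∷ _) = contradiction (sym a≡k) k≢a
drop-key (there a∈ks ∷ keys) (_ ∷ absent) = a∈ks ∷ drop-key keys absent

module _ {n : ℕ} where

  Children : Set
  Children = List (Fin n × Tree n)

  Covered : Forest {n} → Tree n → Set
  Covered F s = ∃ λ t → t ∈ F × s ≅ t

  Layer : Forest {n} → List (Fin n) → Forest {n}
  Layer F = foldr (λ k acc → (root ∷ raise (T k) F) ∧F acc) [ root ]

  ∈-∧F : ∀ {t u : Tree n} {F F′ : Forest} → t ∈ F → u ∈ F′ → t ∧ u ∈ F ∧F F′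
  ∈-∧F {t} t∈F u∈F′ = ∈-concat⁺′ (∈-map⁺ (t ∧_) u∈F′) (∈-map⁺ _ t∈F)

  skip-label : ∀ {F k ks ds} → node ds ∈ Layer F ks → node ds ∈ Layer F (k ∷ ks)
  skip-label {F} {k} {ks} = ∈-∧F {F = root ∷ raise (T k) F} {F′ = Layer F ks} (here ≡-refl)

  use-label : ∀ {F k ks ds t} → t ∈ F → node ds ∈ Layer F ks →
              node ((k , t) ∷ ds) ∈ Layer F (k ∷ ks)
  use-label {F} {k} {ks} t∈F = ∈-∧F {F′ = Layer F ks} (there (∈-map⁺ (attach (T k)) t∈F))

  ≅-permute : ∀ {cs cs′ : Children} {t : Tree n} → cs ↭ cs′ → node cs′ ≅ t → node cs ≅ t
  ≅-permute cs↭cs′ (iso cs′↭es es∼ds) = iso (trans cs↭cs′ cs′↭es) es∼ds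

  ≅-cons : ∀ {k : Fin n} {s t : Tree n} {cs ds : Children} →
           s ≅ t → node cs ≅ node ds → node ((k , s) ∷ cs) ≅ node ((k , t) ∷ ds)
  ≅-cons s≅t (iso cs↭es es∼ds) = iso (prep _ cs↭es) ((≡-refl , s≅t) ∷ es∼ds)

  layer-complete : ∀ {F} ks (cs : Children) →
                   All (λ c → proj₁ c ∈ ks) cs → All (λ c → Covered F (proj₂ c)) cs →
                   AllPairs DistinctKeys cs → Covered (Layer F ks) (node cs)
  layer-complete [] [] [] [] [] = root , here ≡-refl , iso refl []
  layer-complete [] (_ ∷ _) (() ∷ _) _ _
  layer-complete {F} (k ∷ ks) cs labels covered distinct with extract _≟_ k cs
  ... | inj₁ k-absent
    with node ds , ds∈ , cs≅ds ← layer-complete {F} ks cs (drop-key labels k-absent) covered distinct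
    = node ds , skip-label {F} {k} {ks} ds∈ , cs≅ds
  ... | inj₂ (s , cs′ , cs↭) with All-resp-↭ cs↭ labels | All-resp-↭ cs↭ covered | distinct-resp-↭ cs↭ distinct
  ...   | _ ∷ labels′ | (t , t∈F , s≅t) ∷ covered′ | k-absent ∷ distinct′
    with node ds , ds∈ , cs′≅ds ← layer-complete {F} ks cs′ (drop-key labels′ k-absent) covered′ distinct′
    = node ((k , t) ∷ ds) , use-label {F} {k} {ks} t∈F ds∈ , ≅-permute cs↭ (≅-cons s≅t cs′≅ds)

  children-lower : ∀ {h} (cs : Children) → heights cs ≤ h → All (λ c → height (proj₂ c) < h) cs
  children-lower [] _ = []
  children-lower ((_ , s) ∷ cs) hcs≤h =
    m⊔n≤o⇒m≤o (suc (height s)) (heights cs) hcs≤h ∷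
    children-lower cs (m⊔n≤o⇒n≤o (suc (height s)) (heights cs) hcs≤h)

  complete : ∀ h (t : Tree n) → Valid t → height t ≤ h → Covered (G n h) t
  complete zero (node []) _ _ = root , here ≡-refl , iso refl []
  complete zero (node (c ∷ cs)) _ ht with children-lower (c ∷ cs) ht
  ... | () ∷ _
  complete (suc i) (node cs) (valid unique valids) ht =
    layer-complete (allFin n) cs
      (All.universal (λ c → ∈-allFin (proj₁ c)) cs)
      (All.zipWith (λ (v , lower) → complete i _ v (≤-pred lower)) (valids , children-lower cs ht))
      (AllPairs.map⁻ unique)

theorem1 : (n : ℕ) → 1 ≤ n → (h : ℕ) → (t : Tree n) → Valid t → height t ≤ h →
    ∃ λ t′ → t′ ∈ G n h × t ≅ t′
theorem1 n _ = complete
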